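{- Let $d\ge 2$ be an integer and let $G$ be a $\{K_{d,d},P_4\}$-free graph. Then $\mathsf{tree}\text{ - }\alpha(G)\le d-1$.
   Context: Graphs are finite and simple; $G$ is $\{H_1,H_2\}$-free if it has no induced subgraph isomorphic to $H_1$ or $H_2$. $K_{d,d}$ is the complete bipartite graph with both sides of size $d$, $P_4$ the path on 4 vertices. A tree decomposition of $G$ is a pair $(T,\beta)$ with $T$ a tree and $\beta:V(T)\to 2^{V(G)}$ such that every vertex lies in some bag, every edge has both endpoints in some bag, and for each vertex the nodes whose bags contain it induce a subtree. Its independence number is $\max_t\alpha(G[\beta(t)])$; $\mathsf{tree}\text{ - }\alpha(G)$ is the minimum independence number over all tree decompositions of $G$. -}

module Defs where

open import Data.Nat using (ℕ; suc; _+_; _<_; _≤_; _∸_)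
open import Data.Nat.Properties using (_<?_)
open import Data.Fin using (Fin; toℕ)
open import Data.Fin.Subset using (Subset; _∈_; _⊆_; ∣_∣)
open import Data.Bool using (Bool; true; false; _xor_)
open import Data.Product using (Σ; _×_; ∃; ∃-syntax)
open import Relation.Nullary using (¬_)
open import Relation.Nullary.Decidable using (⌊_⌋)
open import Relation.Binary.PropositionalEquality using (_≡_)
open import Function.Definitions using (Injective)

record Graph (n : ℕ) : Set where
  field
    adj    : Fin n → Fin n → Bool
    sym    : ∀ x y → adj x y ≡ adj y x
    irrefl : ∀ x → adj x x ≡ false
open Graph public

InducedSub : ∀ {k n} → Graph k → Graph n → Set
InducedSub {k} {n} H G =
  Σ (Fin k → Fin n) λ f → Injective _≡_ _≡_ f × (∀ i j → adj H i j ≡ adj G (f i) (f j))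

side : ∀ {d} → Fin (d + d) → Bool
side {d} i = ⌊ toℕ i <? d ⌋

Kdd : (d : ℕ) → Graph (d + d)
Kdd d = record { adj = λ i j → side {d} i xor side {d} j ; sym = s ; irrefl = ir }
  where
  s : ∀ x y → (side {d} x xor side {d} y) ≡ (side {d} y xor side {d} x)
  s x y with side {d} x | side {d} y
  ... | true  | true  = Relation.Binary.PropositionalEquality.refl
  ... | true  | false = Relation.Binary.PropositionalEquality.refl
  ... | false | true  = Relation.Binary.PropositionalEquality.refl
  ... | false | false = Relation.Binary.PropositionalEquality.refl
  ir : ∀ x → (side {d} x xor side {d} x) ≡ false
  ir x with side {d} x
  ... | true  = Relation.Binary.PropositionalEquality.refl
  ... | false = Relation.Binary.PropositionalEquality.refl

P4adj : Fin 4 → Fin 4 → Bool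
P4adj i j = ⌊ suc (toℕ i) Data.Nat.≟ toℕ j ⌋ Data.Bool.∨ ⌊ suc (toℕ j) Data.Nat.≟ toℕ i ⌋

P4 : Graph 4
P4 = record { adj = P4adj ; sym = s ; irrefl = ir }
  where
  open import Relation.Binary.PropositionalEquality using (refl)
  s : ∀ x y → P4adj x y ≡ P4adj y x
  s Fin.zero Fin.zero = refl
  s Fin.zero (Fin.suc Fin.zero) = refl
  s Fin.zero (Fin.suc (Fin.suc Fin.zero)) = refl
  s Fin.zero (Fin.suc (Fin.suc (Fin.suc Fin.zero))) = refl
  s (Fin.suc Fin.zero) Fin.zero = refl
  s (Fin.suc Fin.zero) (Fin.suc Fin.zero) = refl
  s (Fin.suc Fin.zero) (Fin.suc (Fin.suc Fin.zero)) = refl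
  s (Fin.suc Fin.zero) (Fin.suc (Fin.suc (Fin.suc Fin.zero))) = refl
  s (Fin.suc (Fin.suc Fin.zero)) Fin.zero = refl
  s (Fin.suc (Fin.suc Fin.zero)) (Fin.suc Fin.zero) = refl
  s (Fin.suc (Fin.suc Fin.zero)) (Fin.suc (Fin.suc Fin.zero)) = refl
  s (Fin.suc (Fin.suc Fin.zero)) (Fin.suc (Fin.suc (Fin.suc Fin.zero))) = refl
  s (Fin.suc (Fin.suc (Fin.suc Fin.zero))) Fin.zero = refl
  s (Fin.suc (Fin.suc (Fin.suc Fin.zero))) (Fin.suc Fin.zero) = refl
  s (Fin.suc (Fin.suc (Fin.suc Fin.zero))) (Fin.suc (Fin.suc Fin.zero)) = refl
  s (Fin.suc (Fin.suc (Fin.suc Fin.zero))) (Fin.suc (Fin.suc (Fin.suc Fin.zero))) = refl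
  ir : ∀ x → P4adj x x ≡ false
  ir Fin.zero = refl
  ir (Fin.suc Fin.zero) = refl
  ir (Fin.suc (Fin.suc Fin.zero)) = refl
  ir (Fin.suc (Fin.suc (Fin.suc Fin.zero))) = refl

data Walk {n : ℕ} (R : Fin n → Fin n → Set) : Fin n → Fin n → Set where
  nil  : ∀ {a} → Walk R a a
  cons : ∀ {a b c} → R a b → Walk R b c → Walk R a c

EdgeIn : ∀ {n} → Graph n → (Fin n → Set) → Fin n → Fin n → Set
EdgeIn G P x y = P x × P y × adj G x y ≡ true

ConnectedSet : ∀ {n} → Graph n → (Fin n → Set) → Set
ConnectedSet {n} G P = ∀ (a b : Fin n) → P a → P b → Walk (EdgeIn G P) a b

Connected : ∀ {n} → Graph n → Set
Connected G = ∀ a b → Walk (λ x y → adj G x y ≡ true) a b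

-- A tree: a nonempty connected graph in which every edge is a bridge
-- (i.e. a minimally connected graph, equivalently connected and acyclic).
IsTree : ∀ {m} → Graph (suc m) → Set
IsTree T = Connected T ×
  (∀ u v → adj T u v ≡ true →
     ¬ Walk (λ x y → adj T x y ≡ true × ¬ (x ≡ u × y ≡ v) × ¬ (x ≡ v × y ≡ u)) u v)

Independent : ∀ {n} → Graph n → Subset n → Set
Independent G I = ∀ x y → x ∈ I → y ∈ I → adj G x y ≡ false

αAtMost : ∀ {n} → Graph n → Subset n → ℕ → Set
αAtMost G B k = ∀ I → I ⊆ B → Independent G I → ∣ I ∣ ≤ k

record TreeDecomposition {n : ℕ} (G : Graph n) : Set where
  field
    m      : ℕ
    T      : Graph (suc m)
    isTree : IsTree T
    β      : Fin (suc m) → Subset n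
    vcover : ∀ v → ∃[ t ] v ∈ β t
    ecover : ∀ u v → adj G u v ≡ true → ∃[ t ] (u ∈ β t × v ∈ β t)
    subtree : ∀ v → ConnectedSet T (λ t → v ∈ β t)

TreeαAtMost : ∀ {n} → Graph n → ℕ → Set
TreeαAtMost G k = Σ (TreeDecomposition G) λ D →
  ∀ t → αAtMost G (TreeDecomposition.β D t) k

module Submission where

-- A P4-free graph on at least two vertices has a homogeneous cut: a partition into two nonempty
-- parts with either no edges or all edges between them. It is found by removing a vertex v, cutting
-- the rest and reinserting v. After complementing if necessary (P4 is self-complementary) the cut
-- is edgeless, and the only obstruction to placing v, an edge from a neighbour to a non-neighbour
-- of v, would create an induced P4. Recursing along these cuts builds a path decomposition. Across
-- an edgeless cut the two paths are concatenated. Across a complete cut one side A has no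
-- independent set of size d, since two such sets would induce K_{d,d}; adding A to every bag of
-- the decomposition of the other side keeps α ≤ d - 1, as an independent set meets only one side
-- of a complete cut. A path is a tree.

open import Defs
import Data.Nat as ℕ
open import Data.Nat using (ℕ; zero; suc; _<_; _≤_; _+_; _∸_; z≤n; s≤s; _≤?_; _<?_)
open import Data.Nat.Properties
  using ( ≤-refl; ≤-trans; ≤-reflexive; ≤-antisym; ≤-pred; <-irrefl; <-≤-trans; ≤-<-trans; n≤1+n; m≤m+n
        ; +-identityʳ; +-suc; +-monoʳ-≤; m+[n∸m]≡n; m+n∸m≡n; ∸-monoˡ-≤; ∸-monoˡ-<; ∸-cancelʳ-≡
        ; ≰⇒≥; ≰⇒>; ≮⇒≥; 1+n≢n)
open import Data.Nat.Induction using (<-wellFounded)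
import Data.Bool as Bool
open import Data.Bool using (Bool; true; false; not; _∨_)
open import Data.Bool.Properties using (∨-comm; ¬-not; not-¬)
open import Data.Fin using (Fin; toℕ; fromℕ<)
open import Data.Fin.Properties
  using (toℕ-injective; toℕ-fromℕ<; toℕ<n; suc-injective; fromℕ<-injective; _≟_; any?; all?)
import Data.Fin.Subset as Subset
open import Data.Fin.Subset using (Subset; _∈_; _∉_; _⊆_; ∣_∣; _─_; _-_; _∪_; _∩_; ⁅_⁆; inside; outside)
open import Data.Fin.Subset.Properties
  using ( Empty-unique; ∣⊥∣≡0; ∈⊤; _∈?_; _⊆?_; anySubset?; x∈⁅x⁆; x∈⁅y⁆⇒x≡y; x≢y⇒x∉⁅y⁆; x∉⁅y⁆⇒x≢y
        ; x∈p∧x≢y⇒x∈p-y; x∈p∧x∉q⇒x∈p─q; p─q⊆p; x∈p∪q⁺; x∈p∪q⁻; x∈p∩q⁺; x∈p∩q⁻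
        ; x∈p⇒∣p-x∣<∣p∣; p⊂q⇒∣p∣<∣q∣)
open import Data.Vec using ([]; _∷_; here; there; tabulate)
open import Data.Vec.Properties using (lookup∘tabulate; lookup⇒[]=; []=⇒lookup)
open import Data.Product using (_×_; _,_; proj₁; proj₂; ∃; ∃-syntax)
open import Data.Sum using (_⊎_; inj₁; inj₂; swap)
open import Data.Unit using (tt) renaming (⊤ to Unit)
open import Data.Empty using (⊥; ⊥-elim)
open import Function using (_∘_; _on_)
open import Function.Definitions using (Injective)
open import Induction.WellFounded using (Acc; acc)
open import Relation.Binary.Construct.On using (wellFounded)
open import Relation.Binary.PropositionalEquality
  using (_≡_; _≢_; refl; trans; cong; subst)
  renaming (sym to ≡-sym)
open import Relation.Nullary using (¬_; Dec; yes; no; contradiction; ¬?)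
open import Relation.Nullary.Decidable using (⌊_⌋; _×-dec_; _→-dec_; decidable-stable; toWitness)

x∈p─q⇒x∉q : ∀ {n} {x : Fin n} (p q : Subset n) → x ∈ p ─ q → x ∉ q
x∈p─q⇒x∉q (_ ∷ p) (_ ∷ q) (there x∈p─q) (there x∈q) = x∈p─q⇒x∉q p q x∈p─q x∈q
x∈p─q⇒x∉q (inside ∷ p) (inside ∷ q) () here
x∈p─q⇒x∉q (outside ∷ p) (inside ∷ q) () here

subsingleton⇒∣p∣≤1 : ∀ {n} (p : Subset n) → (∀ x y → x ∈ p → y ∈ p → x ≡ y) → ∣ p ∣ ≤ 1
subsingleton⇒∣p∣≤1 [] _ = z≤n
subsingleton⇒∣p∣≤1 (outside ∷ p) eq =
  subsingleton⇒∣p∣≤1 p (λ x y x∈p y∈p → suc-injective (eq _ _ (there x∈p) (there y∈p)))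
subsingleton⇒∣p∣≤1 {suc n} (inside ∷ p) eq =
  s≤s (≤-reflexive (trans (cong ∣_∣ (Empty-unique λ { (x , x∈p) → zero≢suc x x∈p })) (∣⊥∣≡0 n)))
  where
  zero≢suc : ∀ x → x ∈ p → ⊥
  zero≢suc x x∈p with eq Fin.zero (Fin.suc x) here (there x∈p)
  ... | ()

element : ∀ {n} (p : Subset n) → Fin ∣ p ∣ → Fin n
element (inside ∷ p) Fin.zero = Fin.zero
element (inside ∷ p) (Fin.suc i) = Fin.suc (element p i)
element (outside ∷ p) i = Fin.suc (element p i)

element-∈ : ∀ {n} (p : Subset n) i → element p i ∈ p
element-∈ (inside ∷ p) Fin.zero = here
element-∈ (inside ∷ p) (Fin.suc i) = there (element-∈ p i)
element-∈ (outside ∷ p) i = there (element-∈ p i)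

element-injective : ∀ {n} (p : Subset n) {i j} → element p i ≡ element p j → i ≡ j
element-injective (inside ∷ p) {Fin.zero} {Fin.zero} _ = refl
element-injective (inside ∷ p) {Fin.suc i} {Fin.suc j} e = cong Fin.suc (element-injective p (suc-injective e))
element-injective (outside ∷ p) e = element-injective p (suc-injective e)

∈-tabulate⁺ : ∀ {n} (P : Fin n → Bool) {x} → P x ≡ true → x ∈ tabulate P
∈-tabulate⁺ P {x} Px = lookup⇒[]= x (tabulate P) (trans (lookup∘tabulate P x) Px)

∈-tabulate⁻ : ∀ {n} (P : Fin n → Bool) {x} → x ∈ tabulate P → P x ≡ true
∈-tabulate⁻ P {x} x∈ = trans (≡-sym (lookup∘tabulate P x)) ([]=⇒lookup x∈)

module _ {n : ℕ} where
  Walk-map : ∀ {R R' : Fin n → Fin n → Set} → (∀ {x y} → R x y → R' x y) →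
             ∀ {a b} → Walk R a b → Walk R' a b
  Walk-map f nil = nil
  Walk-map f (cons r w) = cons (f r) (Walk-map f w)

  Walk-snoc : ∀ {R : Fin n → Fin n → Set} {a b c} → Walk R a b → R b c → Walk R a c
  Walk-snoc nil r = cons r nil
  Walk-snoc (cons r w) r' = cons r (Walk-snoc w r')

  Walk-reverse : ∀ {R : Fin n → Fin n → Set} → (∀ {x y} → R x y → R y x) →
                 ∀ {a b} → Walk R a b → Walk R b a
  Walk-reverse R-sym nil = nil
  Walk-reverse R-sym (cons r w) = Walk-snoc (Walk-reverse R-sym w) (R-sym r)

Path : (m : ℕ) → Graph (suc m)
Path m = record
  { adj = λ i j → ⌊ suc (toℕ i) ℕ.≟ toℕ j ⌋ ∨ ⌊ suc (toℕ j) ℕ.≟ toℕ i ⌋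
  ; sym = λ i j → ∨-comm ⌊ suc (toℕ i) ℕ.≟ toℕ j ⌋ ⌊ suc (toℕ j) ℕ.≟ toℕ i ⌋
  ; irrefl = irrefl′ }
  where
  irrefl′ : ∀ i → (⌊ suc (toℕ i) ℕ.≟ toℕ i ⌋ ∨ ⌊ suc (toℕ i) ℕ.≟ toℕ i ⌋) ≡ false
  irrefl′ i with suc (toℕ i) ℕ.≟ toℕ i
  ... | yes 1+i≡i = contradiction 1+i≡i 1+n≢n
  ... | no _ = refl

module _ {m : ℕ} where
  Path-adj⁺ : ∀ (i j : Fin (suc m)) → suc (toℕ i) ≡ toℕ j → adj (Path m) i j ≡ true
  Path-adj⁺ i j 1+i≡j with suc (toℕ i) ℕ.≟ toℕ j
  ... | yes _ = refl
  ... | no 1+i≢j = contradiction 1+i≡j 1+i≢j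

  Path-adj⁻ : ∀ (i j : Fin (suc m)) → adj (Path m) i j ≡ true →
              suc (toℕ i) ≡ toℕ j ⊎ suc (toℕ j) ≡ toℕ i
  Path-adj⁻ i j with suc (toℕ i) ℕ.≟ toℕ j | suc (toℕ j) ℕ.≟ toℕ i
  ... | yes 1+i≡j | _ = λ _ → inj₁ 1+i≡j
  ... | no _ | yes 1+j≡i = λ _ → inj₂ 1+j≡i
  ... | no _ | no _ = λ ()

Between : ℕ → ℕ → ℕ → Set
Between a t b = (a ≤ t × t ≤ b) ⊎ (b ≤ t × t ≤ a)

module _ {m : ℕ} (P : Fin (suc m) → Set) where
  private
    PathWalk : Fin (suc m) → Fin (suc m) → Set
    PathWalk = Walk (EdgeIn (Path m) P)

  ascending-walk : ∀ k (a b : Fin (suc m)) → toℕ a + k ≡ toℕ b →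
                   (∀ t → toℕ a ≤ toℕ t → toℕ t ≤ toℕ b → P t) → PathWalk a b
  ascending-walk zero a b a+0≡b inP =
    subst (PathWalk a) (toℕ-injective (trans (≡-sym (+-identityʳ _)) a+0≡b)) nil
  ascending-walk (suc k) a b a+1+k≡b inP =
    cons (inP a ≤-refl a≤b , inP a⁺ a≤a⁺ a⁺≤b , Path-adj⁺ a a⁺ (≡-sym a⁺≡1+a))
         (ascending-walk k a⁺ b a⁺+k≡b (λ t a⁺≤t → inP t (≤-trans a≤a⁺ a⁺≤t)))
    where
    1+a+k≡b : suc (toℕ a + k) ≡ toℕ b
    1+a+k≡b = trans (≡-sym (+-suc (toℕ a) k)) a+1+k≡b
    1+a≤b : suc (toℕ a) ≤ toℕ b
    1+a≤b = ≤-trans (s≤s (m≤m+n (toℕ a) k)) (≤-reflexive 1+a+k≡b)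
    a≤b : toℕ a ≤ toℕ b
    a≤b = ≤-trans (n≤1+n _) 1+a≤b
    1+a<1+m : suc (toℕ a) < suc m
    1+a<1+m = ≤-<-trans 1+a≤b (toℕ<n b)
    a⁺ : Fin (suc m)
    a⁺ = fromℕ< 1+a<1+m
    a⁺≡1+a : toℕ a⁺ ≡ suc (toℕ a)
    a⁺≡1+a = toℕ-fromℕ< 1+a<1+m
    a≤a⁺ : toℕ a ≤ toℕ a⁺
    a≤a⁺ = ≤-trans (n≤1+n _) (≤-reflexive (≡-sym a⁺≡1+a))
    a⁺+k≡b : toℕ a⁺ + k ≡ toℕ b
    a⁺+k≡b = trans (cong (_+ k) a⁺≡1+a) 1+a+k≡b
    a⁺≤b : toℕ a⁺ ≤ toℕ b
    a⁺≤b = ≤-trans (m≤m+n (toℕ a⁺) k) (≤-reflexive a⁺+k≡b)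

  interval-walk : (a b : Fin (suc m)) → (∀ t → Between (toℕ a) (toℕ t) (toℕ b) → P t) → PathWalk a b
  interval-walk a b inP with toℕ a ≤? toℕ b
  ... | yes a≤b =
    ascending-walk (toℕ b ∸ toℕ a) a b (m+[n∸m]≡n a≤b) (λ t a≤t t≤b → inP t (inj₁ (a≤t , t≤b)))
  ... | no a≰b = Walk-reverse EdgeIn-sym
    (ascending-walk (toℕ a ∸ toℕ b) b a (m+[n∸m]≡n (≰⇒≥ a≰b)) (λ t b≤t t≤a → inP t (inj₂ (b≤t , t≤a))))
    where
    EdgeIn-sym : ∀ {x y} → EdgeIn (Path m) P x y → EdgeIn (Path m) P y x
    EdgeIn-sym {x} {y} (Px , Py , xy) = Py , Px , trans (Graph.sym (Path m) y x) xy

module _ {m : ℕ} where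
  private
    AvoidingEdge : (u v x y : Fin (suc m)) → Set
    AvoidingEdge u v x y = adj (Path m) x y ≡ true × ¬ (x ≡ u × y ≡ v) × ¬ (x ≡ v × y ≡ u)

  AvoidingEdge-stays-below : ∀ {p q} → suc (toℕ p) ≡ toℕ q →
                             ∀ {x y} → Walk (AvoidingEdge p q) x y → toℕ x ≤ toℕ p → toℕ y ≤ toℕ p
  AvoidingEdge-stays-below 1+p≡q nil x≤p = x≤p
  AvoidingEdge-stays-below {p} {q} 1+p≡q {x} (cons {b = z} (xz , ¬pq , _) w) x≤p =
    AvoidingEdge-stays-below 1+p≡q w (step (Path-adj⁻ x z xz))
    where
    step : suc (toℕ x) ≡ toℕ z ⊎ suc (toℕ z) ≡ toℕ x → toℕ z ≤ toℕ p
    step (inj₂ 1+z≡x) = ≤-trans (≤-trans (n≤1+n _) (≤-reflexive 1+z≡x)) x≤p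
    step (inj₁ 1+x≡z) with toℕ x <? toℕ p
    ... | yes x<p = ≤-trans (≤-reflexive (≡-sym 1+x≡z)) x<p
    ... | no x≮p = contradiction (x≡p , z≡q) ¬pq
      where
      x≡p : x ≡ p
      x≡p = toℕ-injective (≤-antisym x≤p (≮⇒≥ x≮p))
      z≡q : z ≡ q
      z≡q = toℕ-injective (trans (≡-sym 1+x≡z) (trans (cong (suc ∘ toℕ) x≡p) 1+p≡q))

  Path-isTree : IsTree (Path m)
  Path-isTree = connected , bridge
    where
    connected : Connected (Path m)
    connected a b = Walk-map (λ r → proj₂ (proj₂ r)) (interval-walk (λ _ → Unit) a b (λ _ _ → tt))
    bridge : ∀ u v → adj (Path m) u v ≡ true → ¬ Walk (AvoidingEdge u v) u v
    bridge u v uv w with Path-adj⁻ u v uv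
    ... | inj₁ 1+u≡v = <-irrefl refl (subst (_≤ toℕ u) (≡-sym 1+u≡v) (AvoidingEdge-stays-below 1+u≡v w ≤-refl))
    ... | inj₂ 1+v≡u = <-irrefl refl (subst (_≤ toℕ v) (≡-sym 1+v≡u) (AvoidingEdge-stays-below 1+v≡u w′ ≤-refl))
      where
      reverse-edge : ∀ {x y} → AvoidingEdge u v x y → AvoidingEdge u v y x
      reverse-edge {x} {y} (xy , ¬uv , ¬vu) =
        trans (Graph.sym (Path m) y x) xy
        , (λ (y≡u , x≡v) → ¬vu (x≡v , y≡u)) , (λ (y≡v , x≡u) → ¬uv (x≡u , y≡v))
      w′ : Walk (AvoidingEdge v u) v u
      w′ = Walk-map (λ (xy , ¬uv , ¬vu) → xy , ¬vu , ¬uv) (Walk-reverse reverse-edge w)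

not-flip : ∀ {a c} → not a ≡ c → a ≡ not c
not-flip {true} refl = refl
not-flip {false} refl = refl

module _ {n : ℕ} where
  InducedP4 : (E : Fin n → Fin n → Bool) (a b c d : Fin n) → Set
  InducedP4 E a b c d =
    E a b ≡ true × E b c ≡ true × E c d ≡ true × E a c ≡ false × E b d ≡ false × E a d ≡ false

  P4Free : (Fin n → Fin n → Bool) → Set
  P4Free E = ∀ a b c d → ¬ InducedP4 E a b c d

  Complement : (Fin n → Fin n → Bool) → Fin n → Fin n → Bool
  Complement E x y = not (E x y)

  -- P4 is self-complementary: a - b - c - d in the complement is c - a - d - b in E.
  Complement-P4Free : ∀ {E} → (∀ x y → E x y ≡ E y x) → P4Free E → P4Free (Complement E)
  Complement-P4Free {E} E-sym E-P4Free a b c d (ab , bc , cd , ac , bd , ad) =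
    E-P4Free c a d b ( trans (E-sym c a) (not-flip ac) , not-flip ad , trans (E-sym d b) (not-flip bd)
                     , not-flip cd , not-flip ab , trans (E-sym c b) (not-flip bc))

  record HomogeneousCut (E : Fin n → Fin n → Bool) (S : Subset n) : Set where
    field
      B : Subset n
      B⊆S : B ⊆ S
      a : Fin n
      a∈S : a ∈ S
      a∉B : a ∉ B
      b : Fin n
      b∈B : b ∈ B
      value : Bool
      homogeneous : ∀ x y → x ∈ S → x ∉ B → y ∈ B → E x y ≡ value

    A : Subset n
    A = S ─ B

    A⊆S : A ⊆ S
    A⊆S = p─q⊆p S B

    x∈A⇒x∉B : ∀ {x} → x ∈ A → x ∉ B
    x∈A⇒x∉B = x∈p─q⇒x∉q S B

    x∈S⇒x∈A⊎B : ∀ {x} → x ∈ S → x ∈ A ⊎ x ∈ B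
    x∈S⇒x∈A⊎B {x} x∈S with x ∈? B
    ... | yes x∈B = inj₂ x∈B
    ... | no x∉B = inj₁ (x∈p∧x∉q⇒x∈p─q x∈S x∉B)

    across : ∀ x y → x ∈ A → y ∈ B → E x y ≡ value
    across x y x∈A y∈B = homogeneous x y (A⊆S x∈A) (x∈A⇒x∉B x∈A) y∈B

    ∣A∣<∣S∣ : ∣ A ∣ < ∣ S ∣
    ∣A∣<∣S∣ = p⊂q⇒∣p∣<∣q∣ (A⊆S , b , B⊆S b∈B , λ b∈A → x∈A⇒x∉B b∈A b∈B)

    ∣B∣<∣S∣ : ∣ B ∣ < ∣ S ∣
    ∣B∣<∣S∣ = p⊂q⇒∣p∣<∣q∣ (B⊆S , a , a∈S , a∉B)

  HomogeneousCut-map : ∀ {E E′ S} (f : Bool → Bool) → (∀ {x y c} → E x y ≡ c → E′ x y ≡ f c) →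
                       HomogeneousCut E S → HomogeneousCut E′ S
  HomogeneousCut-map f E⇒E′ cut = record
    { C ; value = f C.value
    ; homogeneous = λ x y x∈S x∉B y∈B → E⇒E′ (C.homogeneous x y x∈S x∉B y∈B) }
    where module C = HomogeneousCut cut

  module ExtendCut (E : Fin n → Fin n → Bool) (E-sym : ∀ x y → E x y ≡ E y x) (E-P4Free : P4Free E)
                   (S : Subset n) (v : Fin n) (v∈S : v ∈ S)
                   (cut : HomogeneousCut E (S - v)) (no-edges : HomogeneousCut.value cut ≡ false) where
    open HomogeneousCut cut

    S′ : Subset n
    S′ = S - v

    ∈S′⁺ : ∀ {x} → x ∈ S → x ≢ v → x ∈ S′
    ∈S′⁺ = x∈p∧x≢y⇒x∈p-y

    ∈S′⇒∈S : ∀ {x} → x ∈ S′ → x ∈ S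
    ∈S′⇒∈S = p─q⊆p S ⁅ v ⁆

    ∈S′⇒≢v : ∀ {x} → x ∈ S′ → x ≢ v
    ∈S′⇒≢v x∈S′ = x∉⁅y⁆⇒x≢y (x∈p─q⇒x∉q S ⁅ v ⁆ x∈S′)

    non-edge : ∀ x y → x ∈ S′ → x ∉ B → y ∈ B → E x y ≡ false
    non-edge x y x∈S′ x∉B y∈B = trans (homogeneous x y x∈S′ x∉B y∈B) no-edges

    v-joins-B : (∀ x → x ∈ S′ → x ∉ B → E v x ≡ false) → HomogeneousCut E S
    v-joins-B no-neighbour-outside = record
      { B = B ∪ ⁅ v ⁆ ; B⊆S = B∪v⊆S ; a = a ; a∈S = ∈S′⇒∈S a∈S ; a∉B = a∉B∪v ; b = v
      ; b∈B = x∈p∪q⁺ (inj₂ (x∈⁅x⁆ v)) ; value = false ; homogeneous = homogeneous′ }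
      where
      B∪v⊆S : B ∪ ⁅ v ⁆ ⊆ S
      B∪v⊆S x∈B∪v with x∈p∪q⁻ B ⁅ v ⁆ x∈B∪v
      ... | inj₁ x∈B = ∈S′⇒∈S (B⊆S x∈B)
      ... | inj₂ x∈v = subst (_∈ S) (≡-sym (x∈⁅y⁆⇒x≡y v x∈v)) v∈S
      a∉B∪v : a ∉ B ∪ ⁅ v ⁆
      a∉B∪v a∈B∪v with x∈p∪q⁻ B ⁅ v ⁆ a∈B∪v
      ... | inj₁ a∈B = a∉B a∈B
      ... | inj₂ a∈v = ∈S′⇒≢v a∈S (x∈⁅y⁆⇒x≡y v a∈v)
      outside-B∪v : ∀ {x} → x ∈ S → x ∉ B ∪ ⁅ v ⁆ → x ∈ S′ × x ∉ B
      outside-B∪v x∈S x∉B∪v =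
        ∈S′⁺ x∈S (λ { refl → x∉B∪v (x∈p∪q⁺ (inj₂ (x∈⁅x⁆ v))) }) , (λ x∈B → x∉B∪v (x∈p∪q⁺ (inj₁ x∈B)))
      homogeneous′ : ∀ x y → x ∈ S → x ∉ B ∪ ⁅ v ⁆ → y ∈ B ∪ ⁅ v ⁆ → E x y ≡ false
      homogeneous′ x y x∈S x∉B∪v y∈B∪v with outside-B∪v x∈S x∉B∪v | x∈p∪q⁻ B ⁅ v ⁆ y∈B∪v
      ... | x∈S′ , x∉B | inj₁ y∈B = non-edge x y x∈S′ x∉B y∈B
      ... | x∈S′ , x∉B | inj₂ y∈v rewrite x∈⁅y⁆⇒x≡y v y∈v = trans (E-sym x v) (no-neighbour-outside x x∈S′ x∉B)

    v-joins-outside : (∀ y → y ∈ B → E v y ≡ false) → HomogeneousCut E S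
    v-joins-outside no-neighbour-in-B = record
      { B = B ; B⊆S = ∈S′⇒∈S ∘ B⊆S ; a = v ; a∈S = v∈S ; a∉B = λ v∈B → ∈S′⇒≢v (B⊆S v∈B) refl
      ; b = b ; b∈B = b∈B ; value = false ; homogeneous = homogeneous′ }
      where
      homogeneous′ : ∀ x y → x ∈ S → x ∉ B → y ∈ B → E x y ≡ false
      homogeneous′ x y x∈S x∉B y∈B with x ≟ v
      ... | yes refl = no-neighbour-in-B y y∈B
      ... | no x≢v = non-edge x y (∈S′⁺ x∈S x≢v) x∉B y∈B

    v-universal : (∀ y → y ∈ S′ → E v y ≡ true) → HomogeneousCut E S
    v-universal universal = record
      { B = S′ ; B⊆S = ∈S′⇒∈S ; a = v ; a∈S = v∈S ; a∉B = λ v∈S′ → ∈S′⇒≢v v∈S′ refl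
      ; b = a ; b∈B = a∈S ; value = true ; homogeneous = homogeneous′ }
      where
      homogeneous′ : ∀ x y → x ∈ S → x ∉ S′ → y ∈ S′ → E x y ≡ true
      homogeneous′ x y x∈S x∉S′ y∈S′ with x ≟ v
      ... | yes refl = universal y y∈S′
      ... | no x≢v = contradiction (∈S′⁺ x∈S x≢v) x∉S′

    non-neighbours-split : ∀ m → m ∈ S′ → E v m ≡ false →
                           (∀ x y → x ∈ S′ → E v x ≡ true → y ∈ S′ → E v y ≡ false → E x y ≡ false) →
                           HomogeneousCut E S
    non-neighbours-split m m∈S′ vm separated = record
      { B = M ; B⊆S = ∈S′⇒∈S ∘ proj₁ ∘ x∈p∩q⁻ S′ _ ; a = v ; a∈S = v∈S
      ; a∉B = λ v∈M → ∈S′⇒≢v (proj₁ (x∈p∩q⁻ S′ _ v∈M)) refl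
      ; b = m ; b∈B = x∈p∩q⁺ (m∈S′ , ∈-tabulate⁺ _ (cong not vm)) ; value = false ; homogeneous = homogeneous′ }
      where
      M : Subset n
      M = S′ ∩ tabulate (Complement E v)
      homogeneous′ : ∀ x y → x ∈ S → x ∉ M → y ∈ M → E x y ≡ false
      homogeneous′ x y x∈S x∉M y∈M with x∈p∩q⁻ S′ _ y∈M | x ≟ v
      ... | _ , y∈N | yes refl = not-flip (∈-tabulate⁻ _ y∈N)
      ... | y∈S′ , y∈N | no x≢v = separated x y x∈S′ vx y∈S′ (not-flip (∈-tabulate⁻ _ y∈N))
        where
        x∈S′ : x ∈ S′
        x∈S′ = ∈S′⁺ x∈S x≢v
        vx : E v x ≡ true
        vx = ¬-not (λ vx≡false → x∉M (x∈p∩q⁺ (x∈S′ , ∈-tabulate⁺ _ (cong not vx≡false))))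

    -- An edge x - y from a neighbour to a non-neighbour of v stays on one side of the cut,
    -- and v has a neighbour z on the other side: y - x - v - z would be an induced P4.
    neighbours-separated : ∀ {p q} → p ∈ S′ → p ∉ B → E v p ≡ true → q ∈ B → E v q ≡ true →
                           ∀ x y → x ∈ S′ → E v x ≡ true → y ∈ S′ → E v y ≡ false → E x y ≡ false
    neighbours-separated {p} {q} p∈S′ p∉B vp q∈B vq x y x∈S′ vx y∈S′ vy =
      ¬-not λ xy → sides xy (x ∈? B) (y ∈? B)
      where
      sides : E x y ≡ true → Dec (x ∈ B) → Dec (y ∈ B) → ⊥
      sides xy (no x∉B) (yes y∈B) = not-¬ xy (non-edge x y x∈S′ x∉B y∈B)
      sides xy (yes x∈B) (no y∉B) = not-¬ xy (trans (E-sym x y) (non-edge y x y∈S′ y∉B x∈B))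
      sides xy (no x∉B) (no y∉B) =
        E-P4Free y x v q ( trans (E-sym y x) xy , trans (E-sym x v) vx , vq , trans (E-sym y v) vy
                         , non-edge x q x∈S′ x∉B q∈B , non-edge y q y∈S′ y∉B q∈B)
      sides xy (yes x∈B) (yes y∈B) =
        E-P4Free y x v p ( trans (E-sym y x) xy , trans (E-sym x v) vx , vp , trans (E-sym y v) vy
                         , trans (E-sym x p) (non-edge p x p∈S′ p∉B x∈B)
                         , trans (E-sym y p) (non-edge p y p∈S′ p∉B y∈B))

    extend : HomogeneousCut E S
    extend with any? (λ x → (x ∈? S′) ×-dec ¬? (x ∈? B) ×-dec (E v x Bool.≟ true))
    ... | no ¬nbr-outside = v-joins-B (λ x x∈S′ x∉B → ¬-not (λ vx → ¬nbr-outside (x , x∈S′ , x∉B , vx)))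
    ... | yes (p , p∈S′ , p∉B , vp) with any? (λ y → (y ∈? B) ×-dec (E v y Bool.≟ true))
    ...   | no ¬nbr-B = v-joins-outside (λ y y∈B → ¬-not (λ vy → ¬nbr-B (y , y∈B , vy)))
    ...   | yes (q , q∈B , vq) with any? (λ m → (m ∈? S′) ×-dec (E v m Bool.≟ false))
    ...     | no ¬non-nbr = v-universal (λ y y∈S′ → ¬-not (λ vy → ¬non-nbr (y , y∈S′ , vy)))
    ...     | yes (m , m∈S′ , vm) = non-neighbours-split m m∈S′ vm (neighbours-separated p∈S′ p∉B vp q∈B vq)

  module _ (E : Fin n → Fin n → Bool) (E-sym : ∀ x y → E x y ≡ E y x) (E-P4Free : P4Free E) where
    extend-cut : ∀ {S v} → v ∈ S → HomogeneousCut E (S - v) → HomogeneousCut E S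
    extend-cut {S} {v} v∈S cut with HomogeneousCut.value cut in value≡
    ... | false = ExtendCut.extend E E-sym E-P4Free S v v∈S cut value≡
    ... | true = HomogeneousCut-map not not-flip
                   (ExtendCut.extend (Complement E) (λ x y → cong not (E-sym x y))
                      (Complement-P4Free E-sym E-P4Free) S v v∈S
                      (HomogeneousCut-map not (cong not) cut) (cong not value≡))

    homogeneousCut-acc : ∀ S → Acc (_<_ on ∣_∣) S → ∀ {v w} → v ∈ S → w ∈ S → v ≢ w → HomogeneousCut E S
    homogeneousCut-acc S (acc smaller) {v} {w} v∈S w∈S v≢w with any? (λ u → (u ∈? S - v) ×-dec ¬? (u ≟ w))
    ... | yes (u , u∈S-v , u≢w) =
      extend-cut v∈S (homogeneousCut-acc (S - v) (smaller (x∈p⇒∣p-x∣<∣p∣ v∈S))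
                        u∈S-v (x∈p∧x≢y⇒x∈p-y w∈S (v≢w ∘ ≡-sym)) u≢w)
    ... | no no-third-vertex = record
      { B = ⁅ w ⁆ ; B⊆S = λ x∈w → subst (_∈ S) (≡-sym (x∈⁅y⁆⇒x≡y w x∈w)) w∈S
      ; a = v ; a∈S = v∈S ; a∉B = x≢y⇒x∉⁅y⁆ v≢w ; b = w ; b∈B = x∈⁅x⁆ w
      ; value = E v w ; homogeneous = homogeneous′ }
      where
      homogeneous′ : ∀ x y → x ∈ S → x ∉ ⁅ w ⁆ → y ∈ ⁅ w ⁆ → E x y ≡ E v w
      homogeneous′ x y x∈S x∉w y∈w with x ≟ v
      ... | yes refl rewrite x∈⁅y⁆⇒x≡y w y∈w = refl
      ... | no x≢v = contradiction (x , x∈p∧x≢y⇒x∈p-y x∈S x≢v , x∉⁅y⁆⇒x≢y x∉w) no-third-vertex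

    homogeneousCut : ∀ {S v w} → v ∈ S → w ∈ S → v ≢ w → HomogeneousCut E S
    homogeneousCut {S} = homogeneousCut-acc S (wellFounded ∣_∣ <-wellFounded S)

-- Only the bags with index ≤ length form the decomposition; the other values of bag are irrelevant.
record PathDecomposition {n : ℕ} (G : Graph n) (k : ℕ) (S : Subset n) : Set where
  field
    length : ℕ
    bag : ℕ → Subset n
    bag⊆S : ∀ i → bag i ⊆ S
    bag-α : ∀ i → αAtMost G (bag i) k
    covers-vertex : ∀ v → v ∈ S → ∃[ i ] (i ≤ length × v ∈ bag i)
    covers-edge : ∀ u v → u ∈ S → v ∈ S → adj G u v ≡ true → ∃[ i ] (i ≤ length × u ∈ bag i × v ∈ bag i)
    convex : ∀ v {i j l} → i ≤ j → j ≤ l → l ≤ length → v ∈ bag i → v ∈ bag l → v ∈ bag j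

module _ {n : ℕ} {G : Graph n} {k : ℕ} where
  single-bag : ∀ {S} → αAtMost G S k → PathDecomposition G k S
  single-bag {S} αS = record
    { length = 0 ; bag = λ _ → S ; bag⊆S = λ _ v∈S → v∈S ; bag-α = λ _ → αS
    ; covers-vertex = λ v v∈S → 0 , z≤n , v∈S ; covers-edge = λ u v u∈S v∈S _ → 0 , z≤n , u∈S , v∈S
    ; convex = λ v _ _ _ v∈S _ → v∈S }

  module Concatenation {X Y S : Subset n} (X⊆S : X ⊆ S) (Y⊆S : Y ⊆ S) (covered : ∀ {x} → x ∈ S → x ∈ X ⊎ x ∈ Y)
                       (disjoint : ∀ {x} → x ∈ X → x ∉ Y) (no-edges : ∀ x y → x ∈ X → y ∈ Y → adj G x y ≡ false)
                       (D₁ : PathDecomposition G k X) (D₂ : PathDecomposition G k Y) where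
    module D₁ = PathDecomposition D₁
    module D₂ = PathDecomposition D₂
    L₁ L₂ : ℕ
    L₁ = D₁.length
    L₂ = D₂.length

    bag : ℕ → Subset n
    bag i with i ≤? L₁
    ... | yes _ = D₁.bag i
    ... | no _ = D₂.bag (i ∸ suc L₁)

    bag-cases : ∀ i → (i ≤ L₁ × bag i ≡ D₁.bag i) ⊎ (¬ i ≤ L₁ × bag i ≡ D₂.bag (i ∸ suc L₁))
    bag-cases i with i ≤? L₁
    ... | yes i≤L₁ = inj₁ (i≤L₁ , refl)
    ... | no i≰L₁ = inj₂ (i≰L₁ , refl)

    in-left : ∀ {v i} → i ≤ L₁ → v ∈ D₁.bag i → v ∈ bag i
    in-left {v} {i} i≤L₁ v∈bag with bag-cases i
    ... | inj₁ (_ , bag≡) = subst (v ∈_) (≡-sym bag≡) v∈bag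
    ... | inj₂ (i≰L₁ , _) = contradiction i≤L₁ i≰L₁

    in-right : ∀ {v} i → v ∈ D₂.bag i → v ∈ bag (suc L₁ + i)
    in-right {v} i v∈bag with bag-cases (suc L₁ + i)
    ... | inj₁ (1+L₁+i≤L₁ , _) = contradiction (≤-trans (s≤s (m≤m+n L₁ i)) 1+L₁+i≤L₁) (<-irrefl refl)
    ... | inj₂ (_ , bag≡) = subst (v ∈_) (≡-sym (trans bag≡ (cong D₂.bag (m+n∸m≡n (suc L₁) i)))) v∈bag

    left≤length : ∀ {i} → i ≤ L₁ → i ≤ L₁ + suc L₂
    left≤length i≤L₁ = ≤-trans i≤L₁ (m≤m+n L₁ _)

    right≤length : ∀ {i} → i ≤ L₂ → suc L₁ + i ≤ L₁ + suc L₂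
    right≤length {i} i≤L₂ = ≤-trans (≤-reflexive (≡-sym (+-suc L₁ i))) (+-monoʳ-≤ L₁ (s≤s i≤L₂))

    bag-from : ∀ {v} i → v ∈ bag i → v ∈ X ⊎ v ∈ Y
    bag-from {v} i v∈bag with bag-cases i
    ... | inj₁ (_ , bag≡) = inj₁ (D₁.bag⊆S i (subst (v ∈_) bag≡ v∈bag))
    ... | inj₂ (_ , bag≡) = inj₂ (D₂.bag⊆S _ (subst (v ∈_) bag≡ v∈bag))

    bag⊆S : ∀ i → bag i ⊆ S
    bag⊆S i v∈bag with bag-from i v∈bag
    ... | inj₁ v∈X = X⊆S v∈X
    ... | inj₂ v∈Y = Y⊆S v∈Y

    bag-α : ∀ i → αAtMost G (bag i) k
    bag-α i I I⊆bag I-indep with bag-cases i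
    ... | inj₁ (_ , bag≡) = D₁.bag-α i I (λ {x} x∈I → subst (x ∈_) bag≡ (I⊆bag x∈I)) I-indep
    ... | inj₂ (_ , bag≡) = D₂.bag-α _ I (λ {x} x∈I → subst (x ∈_) bag≡ (I⊆bag x∈I)) I-indep

    covers-vertex : ∀ v → v ∈ S → ∃[ i ] (i ≤ L₁ + suc L₂ × v ∈ bag i)
    covers-vertex v v∈S with covered v∈S
    ... | inj₁ v∈X = let (i , i≤L₁ , v∈bag) = D₁.covers-vertex v v∈X
                     in i , left≤length i≤L₁ , in-left i≤L₁ v∈bag
    ... | inj₂ v∈Y = let (i , i≤L₂ , v∈bag) = D₂.covers-vertex v v∈Y
                     in suc L₁ + i , right≤length i≤L₂ , in-right i v∈bag

    covers-edge : ∀ u v → u ∈ S → v ∈ S → adj G u v ≡ true → ∃[ i ] (i ≤ L₁ + suc L₂ × u ∈ bag i × v ∈ bag i)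
    covers-edge u v u∈S v∈S uv with covered u∈S | covered v∈S
    ... | inj₁ u∈X | inj₁ v∈X = let (i , i≤L₁ , u∈bag , v∈bag) = D₁.covers-edge u v u∈X v∈X uv
                                in i , left≤length i≤L₁ , in-left i≤L₁ u∈bag , in-left i≤L₁ v∈bag
    ... | inj₂ u∈Y | inj₂ v∈Y = let (i , i≤L₂ , u∈bag , v∈bag) = D₂.covers-edge u v u∈Y v∈Y uv
                                in suc L₁ + i , right≤length i≤L₂ , in-right i u∈bag , in-right i v∈bag
    ... | inj₁ u∈X | inj₂ v∈Y = ⊥-elim (not-¬ uv (no-edges u v u∈X v∈Y))
    ... | inj₂ u∈Y | inj₁ v∈X = ⊥-elim (not-¬ uv (trans (Graph.sym G u v) (no-edges v u v∈X u∈Y)))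

    convex : ∀ v {i j l} → i ≤ j → j ≤ l → l ≤ L₁ + suc L₂ → v ∈ bag i → v ∈ bag l → v ∈ bag j
    convex v {i} {j} {l} i≤j j≤l l≤length v∈i v∈l with bag-cases i | bag-cases j | bag-cases l
    ... | inj₁ (_ , i≡) | inj₁ (_ , j≡) | inj₁ (l≤L₁ , l≡) =
      subst (v ∈_) (≡-sym j≡) (D₁.convex v i≤j j≤l l≤L₁ (subst (v ∈_) i≡ v∈i) (subst (v ∈_) l≡ v∈l))
    ... | _ | inj₂ (j≰L₁ , _) | inj₁ (l≤L₁ , _) = contradiction (≤-trans j≤l l≤L₁) j≰L₁
    ... | inj₂ (i≰L₁ , _) | inj₁ (j≤L₁ , _) | _ = contradiction (≤-trans i≤j j≤L₁) i≰L₁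
    ... | inj₁ (_ , i≡) | _ | inj₂ (_ , l≡) =
      contradiction (D₂.bag⊆S _ (subst (v ∈_) l≡ v∈l)) (disjoint (D₁.bag⊆S i (subst (v ∈_) i≡ v∈i)))
    ... | inj₂ (_ , i≡) | inj₂ (_ , j≡) | inj₂ (_ , l≡) =
      subst (v ∈_) (≡-sym j≡) (D₂.convex v (∸-monoˡ-≤ (suc L₁) i≤j) (∸-monoˡ-≤ (suc L₁) j≤l) l-L₁≤L₂
                                 (subst (v ∈_) i≡ v∈i) (subst (v ∈_) l≡ v∈l))
      where
      l-L₁≤L₂ : l ∸ suc L₁ ≤ L₂
      l-L₁≤L₂ = ≤-trans (∸-monoˡ-≤ (suc L₁) l≤length)
                  (≤-reflexive (trans (cong (_∸ suc L₁) (+-suc L₁ L₂)) (m+n∸m≡n L₁ L₂)))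

    decomposition : PathDecomposition G k S
    decomposition = record
      { length = L₁ + suc L₂ ; bag = bag ; bag⊆S = bag⊆S ; bag-α = bag-α
      ; covers-vertex = covers-vertex ; covers-edge = covers-edge ; convex = convex }

  concatenate : ∀ {X Y S} → X ⊆ S → Y ⊆ S → (∀ {x} → x ∈ S → x ∈ X ⊎ x ∈ Y) → (∀ {x} → x ∈ X → x ∉ Y) →
                (∀ x y → x ∈ X → y ∈ Y → adj G x y ≡ false) →
                PathDecomposition G k X → PathDecomposition G k Y → PathDecomposition G k S
  concatenate = Concatenation.decomposition

  independent-in-join : ∀ {X Y I} → (∀ x y → x ∈ X → y ∈ Y → adj G x y ≡ true) →
                        I ⊆ X ∪ Y → Independent G I → I ⊆ X ⊎ I ⊆ Y
  independent-in-join {X} {Y} {I} complete I⊆X∪Y I-indep with any? (λ x → (x ∈? I) ×-dec ¬? (x ∈? X))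
  ... | no I⊆X = inj₁ λ {x} x∈I → decidable-stable (x ∈? X) (λ x∉X → I⊆X (x , x∈I , x∉X))
  ... | yes (y₀ , y₀∈I , y₀∉X) = inj₂ λ {y} y∈I →
    in-Y y∈I (λ y∈X → not-¬ (complete y y₀ y∈X (in-Y y₀∈I y₀∉X)) (I-indep y y₀ y∈I y₀∈I))
    where
    in-Y : ∀ {y} → y ∈ I → y ∉ X → y ∈ Y
    in-Y {y} y∈I y∉X with x∈p∪q⁻ X Y (I⊆X∪Y y∈I)
    ... | inj₁ y∈X = contradiction y∈X y∉X
    ... | inj₂ y∈Y = y∈Y

  module Join {X Y S : Subset n} (αX : αAtMost G X k) (X⊆S : X ⊆ S) (Y⊆S : Y ⊆ S)
              (covered : ∀ {x} → x ∈ S → x ∈ X ⊎ x ∈ Y) (complete : ∀ x y → x ∈ X → y ∈ Y → adj G x y ≡ true)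
              (D : PathDecomposition G k Y) where
    module D = PathDecomposition D

    bag : ℕ → Subset n
    bag i = X ∪ D.bag i

    in-X : ∀ {v i} → v ∈ X → v ∈ bag i
    in-X v∈X = x∈p∪q⁺ (inj₁ v∈X)

    in-D : ∀ {v i} → v ∈ D.bag i → v ∈ bag i
    in-D v∈bag = x∈p∪q⁺ (inj₂ v∈bag)

    bag⊆S : ∀ i → bag i ⊆ S
    bag⊆S i v∈bag with x∈p∪q⁻ X (D.bag i) v∈bag
    ... | inj₁ v∈X = X⊆S v∈X
    ... | inj₂ v∈D = Y⊆S (D.bag⊆S i v∈D)

    bag-α : ∀ i → αAtMost G (bag i) k
    bag-α i I I⊆bag I-indep
      with independent-in-join (λ x y x∈X y∈D → complete x y x∈X (D.bag⊆S i y∈D)) I⊆bag I-indep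
    ... | inj₁ I⊆X = αX I I⊆X I-indep
    ... | inj₂ I⊆D = D.bag-α i I I⊆D I-indep

    covers-vertex : ∀ v → v ∈ S → ∃[ i ] (i ≤ D.length × v ∈ bag i)
    covers-vertex v v∈S with covered v∈S
    ... | inj₁ v∈X = 0 , z≤n , in-X v∈X
    ... | inj₂ v∈Y = let (i , i≤L , v∈bag) = D.covers-vertex v v∈Y in i , i≤L , in-D v∈bag

    covers-edge : ∀ u v → u ∈ S → v ∈ S → adj G u v ≡ true → ∃[ i ] (i ≤ D.length × u ∈ bag i × v ∈ bag i)
    covers-edge u v u∈S v∈S uv with covered u∈S | covered v∈S
    ... | inj₁ u∈X | inj₁ v∈X = 0 , z≤n , in-X u∈X , in-X v∈X
    ... | inj₁ u∈X | inj₂ v∈Y = let (i , i≤L , v∈bag) = D.covers-vertex v v∈Y in i , i≤L , in-X u∈X , in-D v∈bag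
    ... | inj₂ u∈Y | inj₁ v∈X = let (i , i≤L , u∈bag) = D.covers-vertex u u∈Y in i , i≤L , in-D u∈bag , in-X v∈X
    ... | inj₂ u∈Y | inj₂ v∈Y = let (i , i≤L , u∈bag , v∈bag) = D.covers-edge u v u∈Y v∈Y uv
                                in i , i≤L , in-D u∈bag , in-D v∈bag

    convex : ∀ v {i j l} → i ≤ j → j ≤ l → l ≤ D.length → v ∈ bag i → v ∈ bag l → v ∈ bag j
    convex v {i} {j} {l} i≤j j≤l l≤L v∈i v∈l with v ∈? X
    ... | yes v∈X = in-X v∈X
    ... | no v∉X = in-D (D.convex v i≤j j≤l l≤L (outside-X v∈i) (outside-X v∈l))
      where
      outside-X : ∀ {t} → v ∈ bag t → v ∈ D.bag t
      outside-X {t} v∈bag with x∈p∪q⁻ X (D.bag t) v∈bag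
      ... | inj₁ v∈X = contradiction v∈X v∉X
      ... | inj₂ v∈D = v∈D

    decomposition : PathDecomposition G k S
    decomposition = record
      { length = D.length ; bag = bag ; bag⊆S = bag⊆S ; bag-α = bag-α
      ; covers-vertex = covers-vertex ; covers-edge = covers-edge ; convex = convex }

  join : ∀ {X Y S} → αAtMost G X k → X ⊆ S → Y ⊆ S → (∀ {x} → x ∈ S → x ∈ X ⊎ x ∈ Y) →
         (∀ x y → x ∈ X → y ∈ Y → adj G x y ≡ true) → PathDecomposition G k Y → PathDecomposition G k S
  join = Join.decomposition

PathDecomposition⇒TreeαAtMost : ∀ {n} {G : Graph n} {k} → PathDecomposition G k Subset.⊤ → TreeαAtMost G k
PathDecomposition⇒TreeαAtMost {G = G} {k} D = decomposition , λ t → bag-α (toℕ t)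
  where
  open PathDecomposition D

  node : ∀ {i} → i ≤ length → Fin (suc length)
  node i≤L = fromℕ< (s≤s i≤L)

  in-node : ∀ {v i} (i≤L : i ≤ length) → v ∈ bag i → v ∈ bag (toℕ (node i≤L))
  in-node {v} i≤L = subst (λ j → v ∈ bag j) (≡-sym (toℕ-fromℕ< (s≤s i≤L)))

  decomposition : TreeDecomposition G
  decomposition = record
    { m = length ; T = Path length ; isTree = Path-isTree ; β = bag ∘ toℕ
    ; vcover = λ v → let (i , i≤L , v∈bag) = covers-vertex v ∈⊤ in node i≤L , in-node i≤L v∈bag
    ; ecover = λ u v uv → let (i , i≤L , u∈bag , v∈bag) = covers-edge u v ∈⊤ ∈⊤ uv
                          in node i≤L , in-node i≤L u∈bag , in-node i≤L v∈bag
    ; subtree = λ v a b v∈a v∈b → interval-walk (λ t → v ∈ bag (toℕ t)) a b (between v∈a v∈b) }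
    where
    between : ∀ {v} {a b : Fin (suc length)} → v ∈ bag (toℕ a) → v ∈ bag (toℕ b) →
              ∀ t → Between (toℕ a) (toℕ t) (toℕ b) → v ∈ bag (toℕ t)
    between {v} {a} {b} v∈a v∈b t (inj₁ (a≤t , t≤b)) = convex v a≤t t≤b (≤-pred (toℕ<n b)) v∈a v∈b
    between {v} {a} {b} v∈a v∈b t (inj₂ (b≤t , t≤a)) = convex v b≤t t≤a (≤-pred (toℕ<n a)) v∈b v∈a

module _ {k n : ℕ} {H : Graph k} {G : Graph n} where
  adjacency-preserving⇒injective : (f : Fin k → Fin n) → (∀ i j → adj H i j ≡ adj G (f i) (f j)) →
                                  (∀ i j → (∀ x → adj H i x ≡ adj H j x) → i ≡ j) → Injective _≡_ _≡_ f
  adjacency-preserving⇒injective f preserves rows-distinct {i} {j} fi≡fj = rows-distinct i j λ x →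
    trans (preserves i x) (trans (cong (λ z → adj G z (f x)) fi≡fj) (≡-sym (preserves j x)))

P4-rows-distinct : ∀ i j → (∀ x → adj P4 i x ≡ adj P4 j x) → i ≡ j
P4-rows-distinct =
  toWitness {a? = all? λ i → all? λ j → all? (λ x → adj P4 i x Bool.≟ adj P4 j x) →-dec (i ≟ j)} tt

module _ {n : ℕ} (G : Graph n) where
  InducedP4⇒InducedSub : ∀ {a b c d} → InducedP4 (adj G) a b c d → InducedSub P4 G
  InducedP4⇒InducedSub {a} {b} {c} {d} (ab , bc , cd , ac , bd , ad) =
    f , adjacency-preserving⇒injective {H = P4} {G = G} f preserves P4-rows-distinct , preserves
    where
    f : Fin 4 → Fin n
    f Fin.zero = a
    f (Fin.suc Fin.zero) = b
    f (Fin.suc (Fin.suc Fin.zero)) = c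
    f (Fin.suc (Fin.suc (Fin.suc Fin.zero))) = d
    preserves : ∀ i j → adj P4 i j ≡ adj G (f i) (f j)
    preserves Fin.zero Fin.zero = ≡-sym (irrefl G a)
    preserves Fin.zero (Fin.suc Fin.zero) = ≡-sym ab
    preserves Fin.zero (Fin.suc (Fin.suc Fin.zero)) = ≡-sym ac
    preserves Fin.zero (Fin.suc (Fin.suc (Fin.suc Fin.zero))) = ≡-sym ad
    preserves (Fin.suc Fin.zero) Fin.zero = ≡-sym (trans (Graph.sym G b a) ab)
    preserves (Fin.suc Fin.zero) (Fin.suc Fin.zero) = ≡-sym (irrefl G b)
    preserves (Fin.suc Fin.zero) (Fin.suc (Fin.suc Fin.zero)) = ≡-sym bc
    preserves (Fin.suc Fin.zero) (Fin.suc (Fin.suc (Fin.suc Fin.zero))) = ≡-sym bd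
    preserves (Fin.suc (Fin.suc Fin.zero)) Fin.zero = ≡-sym (trans (Graph.sym G c a) ac)
    preserves (Fin.suc (Fin.suc Fin.zero)) (Fin.suc Fin.zero) = ≡-sym (trans (Graph.sym G c b) bc)
    preserves (Fin.suc (Fin.suc Fin.zero)) (Fin.suc (Fin.suc Fin.zero)) = ≡-sym (irrefl G c)
    preserves (Fin.suc (Fin.suc Fin.zero)) (Fin.suc (Fin.suc (Fin.suc Fin.zero))) = ≡-sym cd
    preserves (Fin.suc (Fin.suc (Fin.suc Fin.zero))) Fin.zero = ≡-sym (trans (Graph.sym G d a) ad)
    preserves (Fin.suc (Fin.suc (Fin.suc Fin.zero))) (Fin.suc Fin.zero) = ≡-sym (trans (Graph.sym G d b) bd)
    preserves (Fin.suc (Fin.suc (Fin.suc Fin.zero))) (Fin.suc (Fin.suc Fin.zero)) = ≡-sym (trans (Graph.sym G d c) cd)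
    preserves (Fin.suc (Fin.suc (Fin.suc Fin.zero))) (Fin.suc (Fin.suc (Fin.suc Fin.zero))) = ≡-sym (irrefl G d)

  independent-complete⇒InducedSub-Kdd : ∀ d {I J} → Independent G I → Independent G J → d ≤ ∣ I ∣ → d ≤ ∣ J ∣ →
                                        (∀ x y → x ∈ I → y ∈ J → adj G x y ≡ true) → InducedSub (Kdd d) G
  independent-complete⇒InducedSub-Kdd d {I} {J} I-indep J-indep d≤∣I∣ d≤∣J∣ complete =
    f , (λ {i} {j} → injective i j) , preserves
    where
    right-index : (i : Fin (d + d)) → ¬ toℕ i < d → toℕ i ∸ d < ∣ J ∣
    right-index i i≮d = <-≤-trans (subst (toℕ i ∸ d <_) (m+n∸m≡n d d) (∸-monoˡ-< (toℕ<n i) (≮⇒≥ i≮d))) d≤∣J∣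

    embed : (i : Fin (d + d)) → Dec (toℕ i < d) → Fin n
    embed i (yes i<d) = element I (fromℕ< (<-≤-trans i<d d≤∣I∣))
    embed i (no i≮d) = element J (fromℕ< (right-index i i≮d))

    f : Fin (d + d) → Fin n
    f i = embed i (toℕ i <? d)

    preserves : ∀ i j → adj (Kdd d) i j ≡ adj G (f i) (f j)
    preserves i j with toℕ i <? d | toℕ j <? d
    ... | yes _ | yes _ = ≡-sym (I-indep _ _ (element-∈ I _) (element-∈ I _))
    ... | yes _ | no _ = ≡-sym (complete _ _ (element-∈ I _) (element-∈ J _))
    ... | no _ | yes _ = ≡-sym (trans (Graph.sym G _ _) (complete _ _ (element-∈ I _) (element-∈ J _)))
    ... | no _ | no _ = ≡-sym (J-indep _ _ (element-∈ J _) (element-∈ J _))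

    across-distinct : ∀ {x y} → x ∈ I → y ∈ J → x ≢ y
    across-distinct {x} x∈I y∈J refl = not-¬ (complete x x x∈I y∈J) (irrefl G x)

    injective : ∀ i j → f i ≡ f j → i ≡ j
    injective i j with toℕ i <? d | toℕ j <? d
    ... | yes i<d | yes j<d = λ fi≡fj →
      toℕ-injective (fromℕ<-injective _ _ _ _ (element-injective I fi≡fj))
    ... | no i≮d | no j≮d = λ fi≡fj →
      toℕ-injective (∸-cancelʳ-≡ (≮⇒≥ i≮d) (≮⇒≥ j≮d) (fromℕ<-injective _ _ _ _ (element-injective J fi≡fj)))
    ... | yes _ | no _ = λ fi≡fj → ⊥-elim (across-distinct (element-∈ I _) (element-∈ J _) fi≡fj)
    ... | no _ | yes _ = λ fi≡fj → ⊥-elim (across-distinct (element-∈ I _) (element-∈ J _) (≡-sym fi≡fj))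

  HasIndependentSet : Subset n → ℕ → Set
  HasIndependentSet X d = ∃ λ I → I ⊆ X × Independent G I × d ≤ ∣ I ∣

  independent? : ∀ I → Dec (Independent G I)
  independent? I = all? λ x → all? λ y → (x ∈? I) →-dec (y ∈? I) →-dec (adj G x y Bool.≟ false)

  hasIndependentSet? : ∀ X d → Dec (HasIndependentSet X d)
  hasIndependentSet? X d = anySubset? λ I → (I ⊆? X) ×-dec (independent? I) ×-dec (d ≤? ∣ I ∣)

  ¬HasIndependentSet⇒αAtMost : ∀ {X d} → ¬ HasIndependentSet X d → αAtMost G X (d ∸ 1)
  ¬HasIndependentSet⇒αAtMost {X} {d} ¬large I I⊆X I-indep with d ≤? ∣ I ∣
  ... | yes d≤∣I∣ = ⊥-elim (¬large (I , I⊆X , I-indep , d≤∣I∣))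
  ... | no d≰∣I∣ = ∸-monoˡ-≤ 1 (≰⇒> d≰∣I∣)

  subsingleton⇒αAtMost : ∀ {S k} → 1 ≤ k → (∀ x y → x ∈ S → y ∈ S → x ≡ y) → αAtMost G S k
  subsingleton⇒αAtMost 1≤k S-subsingleton I I⊆S _ =
    ≤-trans (subsingleton⇒∣p∣≤1 I (λ x y x∈I y∈I → S-subsingleton x y (I⊆S x∈I) (I⊆S y∈I))) 1≤k

module _ {n : ℕ} {G : Graph n} {d : ℕ} (no-Kdd : ¬ InducedSub (Kdd d) G) {S : Subset n}
         (cut : HomogeneousCut (adj G) S) where
  open HomogeneousCut cut

  combine : PathDecomposition G (d ∸ 1) A → PathDecomposition G (d ∸ 1) B → PathDecomposition G (d ∸ 1) S
  combine D-A D-B with value in value≡ | hasIndependentSet? G A d | hasIndependentSet? G B d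
  ... | false | _ | _ =
    concatenate A⊆S B⊆S x∈S⇒x∈A⊎B x∈A⇒x∉B (λ x y x∈A y∈B → trans (across x y x∈A y∈B) value≡) D-A D-B
  ... | true | no ¬large-A | _ =
    join (¬HasIndependentSet⇒αAtMost G ¬large-A) A⊆S B⊆S x∈S⇒x∈A⊎B
         (λ x y x∈A y∈B → trans (across x y x∈A y∈B) value≡) D-B
  ... | true | yes _ | no ¬large-B =
    join (¬HasIndependentSet⇒αAtMost G ¬large-B) B⊆S A⊆S (swap ∘ x∈S⇒x∈A⊎B)
         (λ x y x∈B y∈A → trans (Graph.sym G x y) (trans (across y x y∈A x∈B) value≡)) D-A
  ... | true | yes (I , I⊆A , I-indep , d≤∣I∣) | yes (J , J⊆B , J-indep , d≤∣J∣) =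
    ⊥-elim (no-Kdd (independent-complete⇒InducedSub-Kdd G d I-indep J-indep d≤∣I∣ d≤∣J∣
                     (λ x y x∈I y∈J → trans (across x y (I⊆A x∈I) (J⊆B y∈J)) value≡)))

module _ {n : ℕ} (G : Graph n) (d : ℕ) (2≤d : 2 ≤ d)
         (no-Kdd : ¬ InducedSub (Kdd d) G) (no-P4 : ¬ InducedSub P4 G) where
  P4-free : P4Free (adj G)
  P4-free _ _ _ _ induced = no-P4 (InducedP4⇒InducedSub G induced)

  decompose-acc : ∀ S → Acc (_<_ on ∣_∣) S → PathDecomposition G (d ∸ 1) S
  decompose-acc S (acc smaller) with any? (λ v → any? λ w → (v ∈? S) ×-dec (w ∈? S) ×-dec ¬? (v ≟ w))
  ... | no ¬two = single-bag (subsingleton⇒αAtMost G (∸-monoˡ-≤ 1 2≤d) S-subsingleton)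
    where
    S-subsingleton : ∀ x y → x ∈ S → y ∈ S → x ≡ y
    S-subsingleton x y x∈S y∈S = decidable-stable (x ≟ y) (λ x≢y → ¬two (x , y , x∈S , y∈S , x≢y))
  ... | yes (v , w , v∈S , w∈S , v≢w) =
    combine {d = d} no-Kdd cut (decompose-acc A (smaller ∣A∣<∣S∣)) (decompose-acc B (smaller ∣B∣<∣S∣))
    where
    cut : HomogeneousCut (adj G) S
    cut = homogeneousCut (adj G) (Graph.sym G) P4-free v∈S w∈S v≢w
    open HomogeneousCut cut

  decompose : PathDecomposition G (d ∸ 1) Subset.⊤
  decompose = decompose-acc Subset.⊤ (wellFounded ∣_∣ <-wellFounded Subset.⊤)

theorem1p7 : (d : ℕ) → 2 ≤ d → {n : ℕ} → (G : Graph n) →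
    ¬ InducedSub (Kdd d) G → ¬ InducedSub P4 G →
    TreeαAtMost G (d ∸ 1)
theorem1p7 d 2≤d G no-Kdd no-P4 = PathDecomposition⇒TreeαAtMost (decompose G d 2≤d no-Kdd no-P4)
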